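{- Let $k\ge 2$, let $G$ be an equitably $k$-colorable graph on $n$ vertices, and let $H$ be a $(k-1)$-partite graph. If $k$ divides $n$, then for every integer $l\ge 1$, $\chi_{=}(G\circ^l H)\le k$.
   Context: All graphs are finite, simple and connected. A graph is $r$-partite if its vertex set can be partitioned into $r$ independent sets. A graph is equitably $k$-colorable if its vertex set can be partitioned into $k$ (possibly empty) independent sets $V_1,\dots,V_k$ with $||V_i|-|V_j||\le 1$ for all $i,j$; $\chi_{=}(G)$ is the least $k$ for which $G$ is equitably $k$-colorable. The corona $G\circ H$ is formed from one copy of $G$ and $|V(G)|$ copies of $H$, the $i$-th vertex of $G$ being joined to every vertex of the $i$-th copy of $H$; $G\circ^1 H=G\circ H$ and $G\circ^l H=(G\circ^{l-1}H)\circ H$ for $l\ge 2$. -}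

module Defs where

open import Data.Nat using (ℕ; zero; suc; _+_; _*_; _≤_)
open import Data.Fin using (Fin; splitAt; remQuot)
open import Data.Fin.Properties using (_≟_)
open import Data.Vec using (count)
open import Data.Vec.Base using () renaming (allFin to allFinV)
open import Data.Sum using (_⊎_; inj₁; inj₂)
open import Data.Product using (_×_; _,_; ∃; ∃-syntax; proj₁; proj₂)
open import Relation.Binary.PropositionalEquality using (_≡_; _≢_)
open import Relation.Binary.Construct.Closure.ReflexiveTransitive using (Star)
open import Relation.Nullary using (¬_)

record Graph : Set₁ where
  field
    n   : ℕ
    Adj : Fin n → Fin n → Set
open Graph public

IsSimple : Graph → Set
IsSimple G = (∀ u v → Adj G u v → Adj G v u) × (∀ v → ¬ Adj G v v)

Connected : Graph → Set
Connected G = ∀ u v → Star (Adj G) u v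

Proper : (G : Graph) (k : ℕ) → (Fin (n G) → Fin k) → Set
Proper G k c = ∀ u v → Adj G u v → c u ≢ c v

Partite : ℕ → Graph → Set
Partite r G = ∃[ c ] Proper G r c

classSize : (G : Graph) (k : ℕ) → (Fin (n G) → Fin k) → Fin k → ℕ
classSize G k c i = count (λ v → c v ≟ i) (allFinV (n G))

EquitablyColorable : ℕ → Graph → Set
EquitablyColorable k G =
  ∃[ c ] (Proper G k c × (∀ i j → classSize G k c i ≤ suc (classSize G k c j)))

-- χ₌(G) ≤ k  (χ₌ is the least k' such that G is equitably k'-colourable)
χ₌≤ : Graph → ℕ → Set
χ₌≤ G k = ∃[ k′ ] (k′ ≤ k × EquitablyColorable k′ G)

-- Corona G ∘ H.  Vertices Fin (n + n * m): the first n are the vertices of G,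
-- a vertex p of the remaining n * m stands for vertex h of the i-th copy of H,
-- where (i , h) = remQuot m p.
coronaAdj : (G H : Graph) → Fin (n G) ⊎ Fin (n G * n H) → Fin (n G) ⊎ Fin (n G * n H) → Set
coronaAdj G H (inj₁ a) (inj₁ b) = Adj G a b
coronaAdj G H (inj₁ a) (inj₂ q) = a ≡ proj₁ (remQuot {n G} (n H) q)
coronaAdj G H (inj₂ p) (inj₁ b) = proj₁ (remQuot {n G} (n H) p) ≡ b
coronaAdj G H (inj₂ p) (inj₂ q) =
  proj₁ (remQuot {n G} (n H) p) ≡ proj₁ (remQuot {n G} (n H) q)
  × Adj H (proj₂ (remQuot {n G} (n H) p)) (proj₂ (remQuot {n G} (n H) q))

corona : Graph → Graph → Graph
corona G H = record
  { n   = n G + n G * n H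
  ; Adj = λ x y → coronaAdj G H (splitAt (n G) x) (splitAt (n G) y)
  }

-- G ∘^l H for l ≥ 1 (indexed by l directly; l = 0 gives G ∘ H, unused)
_∘^_ : Graph → ℕ → Graph → Graph
(G ∘^ zero) H = corona G H
(G ∘^ suc zero) H = corona G H
(G ∘^ suc (suc l)) H = corona ((G ∘^ suc l) H) H

-- When k divides n, an equitable k-colouring c of G has all classes of the same
-- size s. Let d be a (k − 1)-colouring of H and give vertex h of the copy of H
-- attached to u the colour c(u) + 1 + d(h) mod k. This avoids c(u) and is proper
-- inside each copy; and since every shift x ↦ x + 1 + d(h) is a bijection of ℤ/k,
-- each colour is used exactly |V(H)| · s times on the copies. So G ∘ H again has a
-- colouring with all classes equal, and the construction iterates.
module Submission where

open import Defs
open import Data.Bool.Base using (true; false; if_then_else_)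
open import Data.Empty using (⊥-elim)
open import Data.Fin using (Fin; zero; suc; toℕ; splitAt; remQuot; combine; _↑ˡ_; _↑ʳ_)
open import Data.Fin.Properties
  using (_≟_; toℕ-injective; toℕ<n; toℕ≤n; toℕ-fromℕ<; suc-injective;
         splitAt-↑ˡ; splitAt-↑ʳ; remQuot-combine)
open import Data.Nat
  using (ℕ; zero; suc; _+_; _*_; _∸_; _≤_; _<_; z≤n; s≤s⁻¹; NonZero)
open import Data.Nat.DivMod
  using (_%_; _mod_; m%n<n; %-distribˡ-+; m%n%n≡m%n; [m+n]%n≡m%n; m<n⇒m%n≡m)
open import Data.Nat.Divisibility using (_∣_; divides)
open import Data.Nat.Properties
  using (+-*-semiring; +-assoc; +-comm; *-comm; +-identityʳ; *-identityʳ; *-zeroʳ;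
         m+[n∸m]≡n; m∸n+n≡m; ≤-refl; ≤-trans; +-mono-≤; +-mono-<-≤; +-mono-≤-<;
         <-irrefl; <-cmp; n≤1+n)
open import Data.Product using (_×_; _,_; ∃-syntax; proj₁; proj₂)
open import Data.Sum using (_⊎_; inj₁; inj₂; [_,_]′)
open import Data.Vec using (count; tabulate)
open import Function using (_∘_)
open import Algebra.Properties.Semiring.Sum +-*-semiring
  using (sum; sum-syntax; sum-cong-≗; ∑-comm)
open import Relation.Binary using (Tri; tri<; tri≈; tri>)
open import Relation.Binary.PropositionalEquality
  using (_≡_; _≢_; refl; sym; trans; cong; cong₂; subst₂; module ≡-Reasoning)
open import Relation.Nullary using (Dec; yes; no; does)
open import Relation.Unary using (Pred; Decidable)

∑-const : ∀ n c → ∑[ i < n ] c ≡ n * c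
∑-const zero    c = refl
∑-const (suc n) c = cong (c +_) (∑-const n c)

∑-mono-≤ : ∀ {n} {f g : Fin n → ℕ} → (∀ i → f i ≤ g i) → sum f ≤ sum g
∑-mono-≤ {zero}  f≤g = z≤n
∑-mono-≤ {suc n} f≤g = +-mono-≤ (f≤g zero) (∑-mono-≤ (f≤g ∘ suc))

∑-mono-< : ∀ {n} {f g : Fin n → ℕ} (t : Fin n) →
           (∀ i → f i ≤ g i) → f t < g t → sum f < sum g
∑-mono-< zero    f≤g ft<gt = +-mono-<-≤ ft<gt (∑-mono-≤ (f≤g ∘ suc))
∑-mono-< (suc t) f≤g ft<gt = +-mono-≤-< (f≤g zero) (∑-mono-< t (f≤g ∘ suc) ft<gt)

∑-↑ : ∀ m {n} (f : Fin (m + n) → ℕ) →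
      sum f ≡ ∑[ i < m ] f (i ↑ˡ n) + ∑[ j < n ] f (m ↑ʳ j)
∑-↑ zero    f = refl
∑-↑ (suc m) f = trans (cong (f zero +_) (∑-↑ m (f ∘ suc))) (sym (+-assoc (f zero) _ _))

∑-combine : ∀ m n (f : Fin (m * n) → ℕ) →
            sum f ≡ ∑[ i < m ] ∑[ j < n ] f (combine i j)
∑-combine zero    n f = refl
∑-combine (suc m) n f =
  trans (∑-↑ n f) (cong (∑[ j < n ] f (j ↑ˡ m * n) +_) (∑-combine m n (f ∘ (n ↑ʳ_))))

nearlyConstant⇒constant : ∀ {k} (f : Fin k → ℕ) q → (∀ i j → f i ≤ suc (f j)) →
                          sum f ≡ q * k → ∀ t → f t ≡ q
nearlyConstant⇒constant {k} f q near total t = compare (<-cmp (f t) q)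
  where
  ∑q≡∑f : ∑[ i < k ] q ≡ sum f
  ∑q≡∑f = trans (∑-const k q) (trans (*-comm k q) (sym total))

  compare : Tri (f t < q) (f t ≡ q) (q < f t) → f t ≡ q
  compare (tri≈ _ ft≡q _) = ft≡q
  compare (tri< ft<q _ _) =
    ⊥-elim (<-irrefl (sym ∑q≡∑f) (∑-mono-< t (λ j → ≤-trans (near j t) ft<q) ft<q))
  compare (tri> _ _ q<ft) =
    ⊥-elim (<-irrefl ∑q≡∑f (∑-mono-< t (λ j → s≤s⁻¹ (≤-trans q<ft (near t j))) q<ft))

𝟙 : ∀ {a} {A : Set a} → Dec A → ℕ
𝟙 a? = if does a? then 1 else 0

𝟙-cong : ∀ {a b} {A : Set a} {B : Set b} → (A → B) → (B → A) →
         (a? : Dec A) (b? : Dec B) → 𝟙 a? ≡ 𝟙 b?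
𝟙-cong A→B B→A (yes _) (yes _) = refl
𝟙-cong A→B B→A (no _)  (no _)  = refl
𝟙-cong A→B B→A (yes a) (no ¬b) = ⊥-elim (¬b (A→B a))
𝟙-cong A→B B→A (no ¬a) (yes b) = ⊥-elim (¬a (B→A b))

count-tabulate : ∀ {a p} {A : Set a} {P : Pred A p} (P? : Decidable P) {n} (f : Fin n → A) →
                 count P? (tabulate f) ≡ ∑[ i < n ] 𝟙 (P? (f i))
count-tabulate P? {zero}  f = refl
count-tabulate P? {suc n} f with does (P? (f zero))
... | true  = cong suc (count-tabulate P? (f ∘ suc))
... | false = count-tabulate P? (f ∘ suc)

∑-𝟙-≟ : ∀ {k} (x : Fin k) → ∑[ t < k ] 𝟙 (x ≟ t) ≡ 1
∑-𝟙-≟ {suc k} zero    = cong suc (trans (∑-const k 0) (*-zeroʳ k))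
∑-𝟙-≟ {suc k} (suc x) = ∑-𝟙-≟ x

fibreSize : ∀ {n k} → (Fin n → Fin k) → Fin k → ℕ
fibreSize {n} c t = ∑[ v < n ] 𝟙 (c v ≟ t)

classSize≡fibreSize : ∀ G k (c : Fin (n G) → Fin k) t → classSize G k c t ≡ fibreSize c t
classSize≡fibreSize G k c t = count-tabulate (λ v → c v ≟ t) (λ v → v)

∑-fibreSize : ∀ {n k} (c : Fin n → Fin k) → ∑[ t < k ] fibreSize c t ≡ n
∑-fibreSize {n} {k} c = begin
  ∑[ t < k ] ∑[ v < n ] 𝟙 (c v ≟ t) ≡⟨ ∑-comm (λ v t → 𝟙 (c v ≟ t)) ⟨
  ∑[ v < n ] ∑[ t < k ] 𝟙 (c v ≟ t) ≡⟨ sum-cong-≗ (∑-𝟙-≟ ∘ c) ⟩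
  ∑[ v < n ] 1                      ≡⟨ ∑-const n 1 ⟩
  n * 1                             ≡⟨ *-identityʳ n ⟩
  n                                 ∎
  where open ≡-Reasoning

fibreSize-∘ : ∀ {n k} (c : Fin n → Fin k) {f g : Fin k → Fin k} →
              (∀ u → g (f u) ≡ u) → (∀ t → f (g t) ≡ t) →
              ∀ t → fibreSize (f ∘ c) t ≡ fibreSize c (g t)
fibreSize-∘ c {f} {g} gf fg t = sum-cong-≗ λ v →
  𝟙-cong (λ fcv≡t → trans (sym (gf (c v))) (cong g fcv≡t))
         (λ cv≡gt → trans (cong f cv≡gt) (fg t))
         (f (c v) ≟ t) (c v ≟ g t)

[m%d+n]%d≡[m+n]%d : ∀ m n d .{{_ : NonZero d}} → (m % d + n) % d ≡ (m + n) % d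
[m%d+n]%d≡[m+n]%d m n d = begin
  (m % d + n) % d           ≡⟨ %-distribˡ-+ (m % d) n d ⟩
  (m % d % d + n % d) % d   ≡⟨ cong (λ x → (x + n % d) % d) (m%n%n≡m%n m d) ⟩
  (m % d + n % d) % d       ≡⟨ %-distribˡ-+ m n d ⟨
  (m + n) % d               ∎
  where open ≡-Reasoning

module CyclicShift (k′ : ℕ) where

  infixl 6 _⊕_ _⊖_

  k : ℕ
  k = suc k′

  _⊕_ : Fin k → Fin k → Fin k
  u ⊕ b = (toℕ u + toℕ b) mod k

  _⊖_ : Fin k → Fin k → Fin k
  u ⊖ b = (toℕ u + (k ∸ toℕ b)) mod k

  private
    toℕ-mod : ∀ m → toℕ (m mod k) ≡ m % k
    toℕ-mod m = toℕ-fromℕ< (m%n<n m k)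

  shift-shift : ∀ u a b → a + b ≡ k → (toℕ ((toℕ u + a) mod k) + b) mod k ≡ u
  shift-shift u a b a+b≡k = toℕ-injective (begin
    toℕ ((toℕ ((toℕ u + a) mod k) + b) mod k) ≡⟨ toℕ-mod (toℕ ((toℕ u + a) mod k) + b) ⟩
    (toℕ ((toℕ u + a) mod k) + b) % k         ≡⟨ cong (λ x → (x + b) % k) (toℕ-mod (toℕ u + a)) ⟩
    ((toℕ u + a) % k + b) % k                 ≡⟨ [m%d+n]%d≡[m+n]%d (toℕ u + a) b k ⟩
    (toℕ u + a + b) % k                       ≡⟨ cong (_% k) (+-assoc (toℕ u) a b) ⟩
    (toℕ u + (a + b)) % k                     ≡⟨ cong (λ x → (toℕ u + x) % k) a+b≡k ⟩
    (toℕ u + k) % k                           ≡⟨ [m+n]%n≡m%n (toℕ u) k ⟩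
    toℕ u % k                                 ≡⟨ m<n⇒m%n≡m (toℕ<n u) ⟩
    toℕ u                                     ∎)
    where open ≡-Reasoning

  ⊖-⊕ : ∀ u b → u ⊕ b ⊖ b ≡ u
  ⊖-⊕ u b = shift-shift u (toℕ b) (k ∸ toℕ b) (m+[n∸m]≡n (toℕ≤n b))

  ⊕-⊖ : ∀ u b → u ⊖ b ⊕ b ≡ u
  ⊕-⊖ u b = shift-shift u (k ∸ toℕ b) (toℕ b) (m∸n+n≡m (toℕ≤n b))

  ⊕-comm : ∀ u b → u ⊕ b ≡ b ⊕ u
  ⊕-comm u b = cong (_mod k) (+-comm (toℕ u) (toℕ b))

  ⊕-identityʳ : ∀ u → u ⊕ zero ≡ u
  ⊕-identityʳ u = toℕ-injective (begin
    toℕ ((toℕ u + 0) mod k) ≡⟨ toℕ-mod (toℕ u + 0) ⟩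
    (toℕ u + 0) % k         ≡⟨ cong (_% k) (+-identityʳ (toℕ u)) ⟩
    toℕ u % k               ≡⟨ m<n⇒m%n≡m (toℕ<n u) ⟩
    toℕ u                   ∎)
    where open ≡-Reasoning

  ⊕-cancelˡ : ∀ u {b b′} → u ⊕ b ≡ u ⊕ b′ → b ≡ b′
  ⊕-cancelˡ u {b} {b′} eq = begin
    b           ≡⟨ ⊖-⊕ b u ⟨
    b ⊕ u ⊖ u   ≡⟨ cong (_⊖ u) (trans (⊕-comm b u) (trans eq (⊕-comm u b′))) ⟩
    b′ ⊕ u ⊖ u  ≡⟨ ⊖-⊕ b′ u ⟩
    b′          ∎
    where open ≡-Reasoning

  ⊕-suc≢ : ∀ u (j : Fin k′) → u ⊕ suc j ≢ u
  ⊕-suc≢ u j eq with ⊕-cancelˡ u (trans eq (sym (⊕-identityʳ u)))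
  ... | ()

  fibreSize-⊕ : ∀ {n} (c : Fin n → Fin k) b t → fibreSize ((_⊕ b) ∘ c) t ≡ fibreSize c (t ⊖ b)
  fibreSize-⊕ c b = fibreSize-∘ c {_⊕ b} {_⊖ b} (λ u → ⊖-⊕ u b) (λ u → ⊕-⊖ u b)

PerfectlyEquitable : ℕ → Graph → Set
PerfectlyEquitable k G = ∃[ c ] (Proper G k c × ∃[ s ] (∀ t → fibreSize c t ≡ s))

perfectlyEquitable⇒equitable : ∀ {k} G → PerfectlyEquitable k G → EquitablyColorable k G
perfectlyEquitable⇒equitable {k} G (c , proper , s , size≡s) = c , proper , λ i j →
  subst₂ (λ a b → a ≤ suc b) (sym (classSize≡s i)) (sym (classSize≡s j)) (n≤1+n s)
  where
  classSize≡s : ∀ t → classSize G k c t ≡ s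
  classSize≡s t = trans (classSize≡fibreSize G k c t) (size≡s t)

equitable⇒perfectlyEquitable : ∀ {k} G → k ∣ n G →
                               EquitablyColorable k G → PerfectlyEquitable k G
equitable⇒perfectlyEquitable {k} G (divides q n≡q*k) (c , proper , near) =
  c , proper , q , nearlyConstant⇒constant (fibreSize c) q near′ (trans (∑-fibreSize c) n≡q*k)
  where
  near′ : ∀ i j → fibreSize c i ≤ suc (fibreSize c j)
  near′ i j = subst₂ (λ a b → a ≤ suc b)
                (classSize≡fibreSize G k c i) (classSize≡fibreSize G k c j) (near i j)

module CoronaColouring {k′ : ℕ} (G H : Graph)
                       (c : Fin (n G) → Fin (suc k′)) (d : Fin (n H) → Fin k′) where

  open CyclicShift k′

  copyColour : Fin (n G * n H) → Fin k
  copyColour p = c (proj₁ (remQuot {n G} (n H) p)) ⊕ suc (d (proj₂ (remQuot {n G} (n H) p)))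

  colour : Fin (n G) ⊎ Fin (n G * n H) → Fin k
  colour = [ c , copyColour ]′

  coronaColour : Fin (n (corona G H)) → Fin k
  coronaColour = colour ∘ splitAt (n G)

  coronaColour-proper : Proper G k c → Proper H k′ d → Proper (corona G H) k coronaColour
  coronaColour-proper c-proper d-proper x y = proper (splitAt (n G) x) (splitAt (n G) y)
    where
    copies-proper : ∀ {i i′ h h′} → i ≡ i′ → Adj H h h′ → c i ⊕ suc (d h) ≢ c i′ ⊕ suc (d h′)
    copies-proper {i} refl h~h′ eq = d-proper _ _ h~h′ (suc-injective (⊕-cancelˡ (c i) eq))

    proper : ∀ a b → coronaAdj G H a b → colour a ≢ colour b
    proper (inj₁ a) (inj₁ b) a~b              = c-proper a b a~b
    proper (inj₁ a) (inj₂ q) refl eq          = ⊕-suc≢ (c a) _ (sym eq)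
    proper (inj₂ p) (inj₁ b) refl eq          = ⊕-suc≢ (c b) _ eq
    proper (inj₂ p) (inj₂ q) (i≡i′ , h~h′) eq = copies-proper i≡i′ h~h′ eq

  copyColour-fibreSize : ∀ s → (∀ t → fibreSize c t ≡ s) →
                         ∀ t → fibreSize copyColour t ≡ n H * s
  copyColour-fibreSize s size≡s t = begin
    ∑[ p < n G * n H ] 𝟙 (copyColour p ≟ t)
      ≡⟨ ∑-combine (n G) (n H) _ ⟩
    ∑[ i < n G ] ∑[ h < n H ] 𝟙 (copyColour (combine i h) ≟ t)
      ≡⟨ sum-cong-≗ (λ i → sum-cong-≗ λ h →
           cong (λ (i , h) → 𝟙 (c i ⊕ suc (d h) ≟ t)) (remQuot-combine i h)) ⟩
    ∑[ i < n G ] ∑[ h < n H ] 𝟙 (c i ⊕ suc (d h) ≟ t)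
      ≡⟨ ∑-comm (λ i h → 𝟙 (c i ⊕ suc (d h) ≟ t)) ⟩
    ∑[ h < n H ] fibreSize ((_⊕ suc (d h)) ∘ c) t
      ≡⟨ sum-cong-≗ (λ h → fibreSize-⊕ c (suc (d h)) t) ⟩
    ∑[ h < n H ] fibreSize c (t ⊖ suc (d h))
      ≡⟨ sum-cong-≗ (λ h → size≡s (t ⊖ suc (d h))) ⟩
    ∑[ h < n H ] s
      ≡⟨ ∑-const (n H) s ⟩
    n H * s ∎
    where open ≡-Reasoning

  coronaColour-fibreSize : ∀ s → (∀ t → fibreSize c t ≡ s) →
                           ∀ t → fibreSize coronaColour t ≡ s + n H * s
  coronaColour-fibreSize s size≡s t = begin
    fibreSize coronaColour t
      ≡⟨ ∑-↑ (n G) _ ⟩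
    ∑[ i < n G ] 𝟙 (coronaColour (i ↑ˡ n G * n H) ≟ t) +
    ∑[ p < n G * n H ] 𝟙 (coronaColour (n G ↑ʳ p) ≟ t)
      ≡⟨ cong₂ _+_ (sum-cong-≗ λ i → cong (λ z → 𝟙 (colour z ≟ t)) (splitAt-↑ˡ (n G) i (n G * n H)))
                   (sum-cong-≗ λ p → cong (λ z → 𝟙 (colour z ≟ t)) (splitAt-↑ʳ (n G) (n G * n H) p)) ⟩
    fibreSize c t + fibreSize copyColour t
      ≡⟨ cong₂ _+_ (size≡s t) (copyColour-fibreSize s size≡s t) ⟩
    s + n H * s ∎
    where open ≡-Reasoning

corona-perfectlyEquitable : ∀ {k′} H → Partite k′ H → ∀ G →
                            PerfectlyEquitable (suc k′) G → PerfectlyEquitable (suc k′) (corona G H)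
corona-perfectlyEquitable H (d , d-proper) G (c , c-proper , s , size≡s) =
  coronaColour , coronaColour-proper c-proper d-proper , _ , coronaColour-fibreSize s size≡s
  where open CoronaColouring G H c d

iterate-corona : ∀ {P : Graph → Set} H → (∀ G → P G → P (corona G H)) →
                 ∀ G → P G → ∀ l → P ((G ∘^ l) H)
iterate-corona H step G PG zero          = step G PG
iterate-corona H step G PG (suc zero)    = step G PG
iterate-corona H step G PG (suc (suc l)) = step _ (iterate-corona H step G PG (suc l))

theorem1 : (k : ℕ) → 2 ≤ k → (G H : Graph) →
           IsSimple G → Connected G → IsSimple H → Connected H →
           EquitablyColorable k G → Partite (k ∸ 1) H → k ∣ n G →
           (l : ℕ) → 1 ≤ l → χ₌≤ ((G ∘^ l) H) k
theorem1 (suc k′) _ G H _ _ _ _ equitable H-partite k∣n l _ =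
  suc k′ , ≤-refl , perfectlyEquitable⇒equitable ((G ∘^ l) H)
    (iterate-corona H (corona-perfectlyEquitable H H-partite) G
       (equitable⇒perfectlyEquitable G k∣n equitable) l)
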